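{- Let $T$ be the $n\times n$ matrix with entries $T_{ij}=1+\operatorname{sgn}(i-j)$ (so $T_{ij}=0$ for $i<j$, $T_{ii}=1$, $T_{ij}=2$ for $i>j$). Then for all $I,J\in\binom{[n]}{k}$, the minor of $T$ with row index set $J$ and column index set $I$ satisfies $$|T_{JI}|=\begin{cases}2^{p(I,J)}, & \text{if } I\le J,\\ 0,&\text{otherwise,}\end{cases}$$ where $p(I,J)=k-\operatorname{card}(I\cap J)$.
   Context: $\binom{[n]}{k}$ is the set of $k$-element subsets of $\{1,\dots,n\}$. For $J=\{j_1<\dots<j_k\}$, $I=\{i_1<\dots<i_k\}$, $|T_{JI}|=\det(T_{j_r i_s})_{r,s=1}^k$. The notation $I\le J$ means $i_1\le j_1\le i_2\le j_2\le\dots\le i_k\le j_k$. -}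

module Defs where

open import Data.Nat as ℕ using (ℕ; zero; suc)
open import Data.Integer as ℤ using (ℤ; +_; _-_; _*_; _+_; -_)
open import Data.Fin as Fin using (Fin; toℕ; punchIn)
open import Data.Fin.Properties using (any?; _≟_)
open import Data.Product using (∃; _×_)
open import Relation.Nullary using (yes; no; Dec)
open import Relation.Binary.PropositionalEquality using (_≡_)

sumF : ∀ {m} → (Fin m → ℤ) → ℤ
sumF {zero} f = + 0
sumF {suc m} f = f Fin.zero + sumF (λ i → f (Fin.suc i))

sgnPow : ℕ → ℤ
sgnPow zero = + 1
sgnPow (suc j) = - sgnPow j

det : ∀ {m} → (Fin m → Fin m → ℤ) → ℤ
det {zero} A = + 1
det {suc m} A =
  sumF (λ j → sgnPow (toℕ j) * A Fin.zero j * det (λ r c → A (Fin.suc r) (punchIn j c)))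

sgn : ℤ → ℤ
sgn (+ zero) = + 0
sgn (+ suc _) = + 1
sgn ℤ.-[1+ _ ] = - (+ 1)

-- T_{ij} = 1 + sgn(i - j)  (0-based indices; only differences matter)
T : (n : ℕ) → Fin n → Fin n → ℤ
T n i j = + 1 + sgn (+ toℕ i - + toℕ j)

-- a k-element subset of [n], listed increasingly: i_1 < ... < i_k
StrictlyIncreasing : ∀ {k n} → (Fin k → Fin n) → Set
StrictlyIncreasing I = ∀ r s → r Fin.< s → I r Fin.< I s

minorT : ∀ n {k} → (J I : Fin k → Fin n) → ℤ
minorT n J I = det (λ r s → T n (J r) (I s))

-- I ≤ J : i_1 ≤ j_1 ≤ i_2 ≤ j_2 ≤ ... ≤ i_k ≤ j_k
_⊴_ : ∀ {k n} → (I J : Fin k → Fin n) → Set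
I ⊴ J = (∀ r → I r Fin.≤ J r) × (∀ r s → suc (toℕ r) ≡ toℕ s → J r Fin.≤ I s)

countF : ∀ {m} {P : Fin m → Set} → (∀ r → Dec (P r)) → ℕ
countF {zero} P? = 0
countF {suc m} P? with P? Fin.zero
... | yes _ = suc (countF (λ r → P? (Fin.suc r)))
... | no _ = countF (λ r → P? (Fin.suc r))

cardInter : ∀ {k n} → (I J : Fin k → Fin n) → ℕ
cardInter I J = countF (λ r → any? (λ s → I r ≟ J s))

p : ∀ {k n} → (I J : Fin k → Fin n) → ℕ
p {k} I J = k ℕ.∸ cardInter I J

-- Expand the minor along its first row J₀.  Every column Iᶜ with a nonzero entry in that row
-- has Iᶜ ≤ J₀ < J₁ < ⋯, so in all lower rows the columns I₀, …, Iᶜ carry the constant 2; hence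
-- deleting column c leaves the same minor as deleting column 0, and the minor factors as
-- (Σ_c (-1)ᶜ T_{J₀ Iᶜ}) · |T_{tail J, tail I}|.  The alternating row sum is 1 when J₀ ∈ {I₀, I₁},
-- 2 when I₀ < J₀ < I₁, and 0 when J₀ < I₀ or I₁ < J₀ < I₂; in the remaining case I₂ ≤ J₀
-- the tails already violate interlacing.  The factor 2 appears exactly when I₀ ∉ J, i.e. when
-- p(I,J) exceeds p of the tails, so induction on k closes.
module Submission where

open import Defs
open import Data.Nat as ℕ using (ℕ; zero; suc; _^_; _∸_; z≤n; s≤s)
import Data.Nat.Properties as ℕₚ
open import Data.Integer using (ℤ; +_; -_; _+_; _-_; _*_; _⊖_)
import Data.Integer.Properties as ℤₚ
open import Data.Fin using (Fin; zero; suc; toℕ; punchIn; _≤_; _<_)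
open import Data.Fin.Properties using (toℕ-injective; _≤?_; <-cmp; any?; _≟_)
open import Data.Vec.Functional using (tail)
open import Data.Product using (∃; _×_; _,_; proj₁; proj₂)
open import Data.Sum using (_⊎_; inj₁; inj₂)
open import Data.Empty using (⊥-elim)
open import Function using (_∘_)
open import Relation.Nullary using (¬_; Dec; yes; no)
open import Relation.Binary using (tri<; tri≈; tri>)
open import Relation.Binary.PropositionalEquality
  using (_≡_; refl; sym; trans; cong; cong₂; subst; module ≡-Reasoning)

open ≡-Reasoning

sgn-⊖-< : ∀ {a b} → a ℕ.< b → sgn (a ⊖ b) ≡ - + 1
sgn-⊖-< {zero}  {suc b} _         = refl
sgn-⊖-< {suc a} {suc b} (s≤s a<b) rewrite ℤₚ.[1+m]⊖[1+n]≡m⊖n a b = sgn-⊖-< a<b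

sgn-⊖-> : ∀ {a b} → b ℕ.< a → sgn (a ⊖ b) ≡ + 1
sgn-⊖-> {suc a} {zero}  _         = refl
sgn-⊖-> {suc a} {suc b} (s≤s b<a) rewrite ℤₚ.[1+m]⊖[1+n]≡m⊖n a b = sgn-⊖-> b<a

module _ {n : ℕ} where

  T-above-diagonal : {i j : Fin n} → i < j → T n i j ≡ + 0
  T-above-diagonal {i} {j} i<j rewrite ℤₚ.m-n≡m⊖n (toℕ i) (toℕ j) | sgn-⊖-< i<j = refl

  T-below-diagonal : {i j : Fin n} → j < i → T n i j ≡ + 2
  T-below-diagonal {i} {j} j<i rewrite ℤₚ.m-n≡m⊖n (toℕ i) (toℕ j) | sgn-⊖-> j<i = refl

  T-diagonal : (i : Fin n) → T n i i ≡ + 1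
  T-diagonal i rewrite ℤₚ.m-n≡m⊖n (toℕ i) (toℕ i) | ℤₚ.n⊖n≡0 (toℕ i) = refl

sumF-cong : ∀ {m} {f g : Fin m → ℤ} → (∀ i → f i ≡ g i) → sumF f ≡ sumF g
sumF-cong {zero}  f≡g = refl
sumF-cong {suc m} f≡g = cong₂ _+_ (f≡g zero) (sumF-cong {m} (f≡g ∘ suc))

sumF-≡0 : ∀ {m} {f : Fin m → ℤ} → (∀ i → f i ≡ + 0) → sumF f ≡ + 0
sumF-≡0 {zero}  f≡0 = refl
sumF-≡0 {suc m} f≡0 = cong₂ _+_ (f≡0 zero) (sumF-≡0 {m} (f≡0 ∘ suc))

sumF-neg : ∀ {m} (f : Fin m → ℤ) → sumF (λ i → - f i) ≡ - sumF f
sumF-neg {zero}  f = refl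
sumF-neg {suc m} f = begin
  (- f zero) + sumF (λ i → - f (suc i))  ≡⟨ cong (_+_ (- f zero)) (sumF-neg (f ∘ suc)) ⟩
  (- f zero) + - sumF (f ∘ suc)          ≡⟨ sym (ℤₚ.neg-distrib-+ (f zero) (sumF (f ∘ suc))) ⟩
  - sumF f                               ∎

sumF-*ʳ : ∀ {m} (f : Fin m → ℤ) (d : ℤ) → sumF (λ i → f i * d) ≡ sumF f * d
sumF-*ʳ {zero}  f d = refl
sumF-*ʳ {suc m} f d = begin
  f zero * d + sumF (λ i → f (suc i) * d)  ≡⟨ cong (_+_ (f zero * d)) (sumF-*ʳ (f ∘ suc) d) ⟩
  f zero * d + sumF (f ∘ suc) * d          ≡⟨ sym (ℤₚ.*-distribʳ-+ d (f zero) (sumF (f ∘ suc))) ⟩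
  sumF f * d                               ∎

det-cong : ∀ {m} {A B : Fin m → Fin m → ℤ} → (∀ r s → A r s ≡ B r s) → det A ≡ det B
det-cong {zero}  A≡B = refl
det-cong {suc m} A≡B = sumF-cong λ j →
  cong₂ _*_ (cong (sgnPow (toℕ j) *_) (A≡B zero j)) (det-cong λ r c → A≡B (suc r) (punchIn j c))

det-factor : ∀ {m} (A : Fin (suc m) → Fin (suc m) → ℤ) (D : ℤ) →
  (∀ c → A zero c ≡ + 0 ⊎ det (λ r s → A (suc r) (punchIn c s)) ≡ D) →
  det A ≡ sumF (λ c → sgnPow (toℕ c) * A zero c) * D
det-factor A D zero⊎D = trans (sumF-cong term) (sumF-*ʳ (λ c → sgnPow (toℕ c) * A zero c) D)
  where
  term : ∀ c → sgnPow (toℕ c) * A zero c * det (λ r s → A (suc r) (punchIn c s))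
             ≡ sgnPow (toℕ c) * A zero c * D
  term c with zero⊎D c
  ... | inj₁ entry≡0 rewrite entry≡0 | ℤₚ.*-zeroʳ (sgnPow (toℕ c)) = refl
  ... | inj₂ minor≡D = cong (sgnPow (toℕ c) * A zero c *_) minor≡D

punchIn-cases : ∀ {m} (c : Fin (suc m)) (s : Fin m) →
  punchIn c s ≡ suc s ⊎ (punchIn c s ≤ c × suc s ≤ c)
punchIn-cases zero    s       = inj₁ refl
punchIn-cases (suc c) zero    = inj₂ (z≤n , s≤s z≤n)
punchIn-cases (suc c) (suc s) with punchIn-cases c s
... | inj₁ punchIn≡suc       = inj₁ (cong suc punchIn≡suc)
... | inj₂ (punchIn≤c , s<c) = inj₂ (s≤s punchIn≤c , s≤s s<c)

module _ {k n : ℕ} {I : Fin k → Fin n} (I↑ : StrictlyIncreasing I) where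

  StrictlyIncreasing⇒monotone : ∀ {r s} → r ≤ s → I r ≤ I s
  StrictlyIncreasing⇒monotone {r} {s} r≤s with ℕₚ.m≤n⇒m<n∨m≡n r≤s
  ... | inj₁ r<s = ℕₚ.<⇒≤ (I↑ r s r<s)
  ... | inj₂ r≡s rewrite toℕ-injective {i = r} {j = s} r≡s = ℕₚ.≤-refl

StrictlyIncreasing-tail : ∀ {k n} {I : Fin (suc k) → Fin n} →
  StrictlyIncreasing I → StrictlyIncreasing (tail I)
StrictlyIncreasing-tail I↑ r s r<s = I↑ (suc r) (suc s) (s≤s r<s)

alternatingRowSum : ∀ {k} n → Fin n → (Fin k → Fin n) → ℤ
alternatingRowSum n j I = sumF (λ c → sgnPow (toℕ c) * T n j (I c))

minorT-expand : ∀ {n k} (I J : Fin (suc k) → Fin n) →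
  StrictlyIncreasing I → StrictlyIncreasing J →
  minorT n J I ≡ alternatingRowSum n (J zero) I * minorT n (tail J) (tail I)
minorT-expand {n} I J I↑ J↑ = det-factor (λ r s → T n (J r) (I s)) (minorT n (tail J) (tail I)) columnCase
  where
  columnCase : ∀ c → T n (J zero) (I c) ≡ + 0
                   ⊎ det (λ r s → T n (J (suc r)) (I (punchIn c s))) ≡ minorT n (tail J) (tail I)
  columnCase c with I c ≤? J zero
  ... | no  Ic≰J₀ = inj₁ (T-above-diagonal (ℕₚ.≰⇒> Ic≰J₀))
  ... | yes Ic≤J₀ = inj₂ (det-cong sameColumn)
    where
    left-of-c-below-row : ∀ {r x} → x ≤ c → I x < J (suc r)
    left-of-c-below-row {r} x≤c =
      ℕₚ.≤-<-trans (ℕₚ.≤-trans (StrictlyIncreasing⇒monotone I↑ x≤c) Ic≤J₀) (J↑ zero (suc r) (s≤s z≤n))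
    sameColumn : ∀ r s → T n (J (suc r)) (I (punchIn c s)) ≡ T n (J (suc r)) (I (suc s))
    sameColumn r s with punchIn-cases c s
    ... | inj₁ punchIn≡suc       = cong (T n (J (suc r)) ∘ I) punchIn≡suc
    ... | inj₂ (punchIn≤c , s<c) = trans (T-below-diagonal (left-of-c-below-row punchIn≤c))
                                         (sym (T-below-diagonal (left-of-c-below-row s<c)))

module _ {n : ℕ} (j : Fin n) where

  alternatingRowSum-cons : ∀ {k} (I : Fin (suc k) → Fin n) →
    alternatingRowSum n j I ≡ T n j (I zero) - alternatingRowSum n j (tail I)
  alternatingRowSum-cons {k} I = cong₂ _+_ (ℤₚ.*-identityˡ (T n j (I zero))) (begin
    sumF (λ c → - sgnPow (toℕ c) * tailTerm c)    ≡⟨ sumF-cong (λ c → sym (ℤₚ.neg-distribˡ-* (sgnPow (toℕ c)) (tailTerm c))) ⟩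
    sumF (λ c → - (sgnPow (toℕ c) * tailTerm c))  ≡⟨ sumF-neg (λ c → sgnPow (toℕ c) * tailTerm c) ⟩
    - alternatingRowSum n j (tail I)              ∎)
    where
    tailTerm : Fin k → ℤ
    tailTerm c = T n j (I (suc c))

  alternatingRowSum-≡0 : ∀ {k} (I : Fin k → Fin n) → (∀ c → j < I c) → alternatingRowSum n j I ≡ + 0
  alternatingRowSum-≡0 I j<I = sumF-≡0 λ c →
    trans (cong (sgnPow (toℕ c) *_) (T-above-diagonal (j<I c))) (ℤₚ.*-zeroʳ (sgnPow (toℕ c)))

  alternatingRowSum-≡1 : ∀ {k} (I : Fin (suc k) → Fin n) →
    I zero ≡ j → (∀ c → j < I (suc c)) → alternatingRowSum n j I ≡ + 1
  alternatingRowSum-≡1 I I₀≡j j<tail = begin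
    alternatingRowSum n j I                         ≡⟨ alternatingRowSum-cons I ⟩
    T n j (I zero) - alternatingRowSum n j (tail I) ≡⟨ cong₂ _-_ (trans (cong (T n j) I₀≡j) (T-diagonal j))
                                                                 (alternatingRowSum-≡0 (tail I) j<tail) ⟩
    + 1 - + 0                                       ∎

  alternatingRowSum-cons-< : ∀ {k} (I : Fin (suc k) → Fin n) →
    I zero < j → alternatingRowSum n j I ≡ + 2 - alternatingRowSum n j (tail I)
  alternatingRowSum-cons-< I I₀<j =
    trans (alternatingRowSum-cons I) (cong (_- alternatingRowSum n j (tail I)) (T-below-diagonal I₀<j))

  alternatingRowSum-≡2 : ∀ {k} (I : Fin (suc k) → Fin n) →
    I zero < j → (∀ c → j < I (suc c)) → alternatingRowSum n j I ≡ + 2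
  alternatingRowSum-≡2 I I₀<j j<tail = begin
    alternatingRowSum n j I                 ≡⟨ alternatingRowSum-cons-< I I₀<j ⟩
    + 2 - alternatingRowSum n j (tail I)    ≡⟨ cong (_-_ (+ 2)) (alternatingRowSum-≡0 (tail I) j<tail) ⟩
    + 2 - + 0                               ∎

countF-≤ : ∀ {m} {P : Fin m → Set} (P? : ∀ r → Dec (P r)) → countF P? ℕ.≤ m
countF-≤ {zero}  P? = z≤n
countF-≤ {suc m} P? with P? zero
... | yes _ = s≤s (countF-≤ (P? ∘ suc))
... | no  _ = ℕₚ.m≤n⇒m≤1+n (countF-≤ (P? ∘ suc))

countF-head-yes : ∀ {m} {P : Fin (suc m) → Set} (P? : ∀ r → Dec (P r)) →
  P zero → countF P? ≡ suc (countF (P? ∘ suc))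
countF-head-yes P? P₀ with P? zero
... | yes _  = refl
... | no ¬P₀ = ⊥-elim (¬P₀ P₀)

countF-head-no : ∀ {m} {P : Fin (suc m) → Set} (P? : ∀ r → Dec (P r)) →
  ¬ P zero → countF P? ≡ countF (P? ∘ suc)
countF-head-no P? ¬P₀ with P? zero
... | yes P₀ = ⊥-elim (¬P₀ P₀)
... | no _   = refl

countF-cong : ∀ {m} {P Q : Fin m → Set} (P? : ∀ r → Dec (P r)) (Q? : ∀ r → Dec (Q r)) →
  (∀ r → P r → Q r) → (∀ r → Q r → P r) → countF P? ≡ countF Q?
countF-cong {zero}  P? Q? P⇒Q Q⇒P = refl
countF-cong {suc m} P? Q? P⇒Q Q⇒P with P? zero | Q? zero
... | yes _  | yes _  = cong suc (countF-cong (P? ∘ suc) (Q? ∘ suc) (P⇒Q ∘ suc) (Q⇒P ∘ suc))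
... | no _   | no _   = countF-cong (P? ∘ suc) (Q? ∘ suc) (P⇒Q ∘ suc) (Q⇒P ∘ suc)
... | yes P₀ | no ¬Q₀ = ⊥-elim (¬Q₀ (P⇒Q zero P₀))
... | no ¬P₀ | yes Q₀ = ⊥-elim (¬P₀ (Q⇒P zero Q₀))

countIn : ∀ {k l n} → (Fin k → Fin n) → (Fin l → Fin n) → ℕ
countIn I J = countF (λ r → any? (λ s → I r ≟ J s))

module _ {k l n : ℕ} where

  countIn-head-∈ : {I : Fin (suc k) → Fin n} {J : Fin l → Fin n} →
    ∃ (λ s → I zero ≡ J s) → countIn I J ≡ suc (countIn (tail I) J)
  countIn-head-∈ {I = I} {J = J} = countF-head-yes (λ r → any? (λ s → I r ≟ J s))

  countIn-tailˡ : {I : Fin (suc k) → Fin n} {J : Fin l → Fin n} →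
    (∀ s → I zero < J s) → countIn I J ≡ countIn (tail I) J
  countIn-tailˡ {I = I} {J = J} I₀<J = countF-head-no (λ r → any? (λ s → I r ≟ J s))
    λ (s , I₀≡Js) → ℕₚ.<⇒≢ (I₀<J s) (cong toℕ I₀≡Js)

  countIn-tailʳ : {I : Fin k → Fin n} {J : Fin (suc l) → Fin n} →
    (∀ r → J zero < I r) → countIn I J ≡ countIn I (tail J)
  countIn-tailʳ {I = I} {J = J} J₀<I =
    countF-cong (λ r → any? (λ s → I r ≟ J s)) (λ r → any? (λ s → I r ≟ J (suc s))) dropHead liftHead
    where
    dropHead : ∀ r → ∃ (λ s → I r ≡ J s) → ∃ (λ s → I r ≡ J (suc s))
    dropHead r (zero  , Ir≡J₀) = ⊥-elim (ℕₚ.<⇒≢ (J₀<I r) (cong toℕ (sym Ir≡J₀)))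
    dropHead r (suc s , Ir≡Js) = s , Ir≡Js
    liftHead : ∀ r → ∃ (λ s → I r ≡ J (suc s)) → ∃ (λ s → I r ≡ J s)
    liftHead r (s , Ir≡Js) = suc s , Ir≡Js

module _ {k n : ℕ} {I J : Fin (suc k) → Fin n} where

  p-tail-shared : cardInter I J ≡ suc (cardInter (tail I) (tail J)) → p I J ≡ p (tail I) (tail J)
  p-tail-shared = cong (suc k ∸_)

  p-tail-unshared : cardInter I J ≡ cardInter (tail I) (tail J) → p I J ≡ suc (p (tail I) (tail J))
  p-tail-unshared card≡ =
    trans (cong (suc k ∸_) card≡) (ℕₚ.+-∸-assoc 1 (countF-≤ (λ r → any? (λ s → I (suc r) ≟ J (suc s)))))

  ⊴-tail : I ⊴ J → tail I ⊴ tail J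
  ⊴-tail (I≤J , J≤I) = I≤J ∘ suc , λ r s 1+r≡s → J≤I (suc r) (suc s) (cong suc 1+r≡s)

  ⊴-cons : I zero ≤ J zero → (∀ s → J zero ≤ I (suc s)) → tail I ⊴ tail J → I ⊴ J
  ⊴-cons I₀≤J₀ J₀≤tail (I≤J , J≤I) = I≤J′ , J≤I′
    where
    I≤J′ : ∀ r → I r ≤ J r
    I≤J′ zero    = I₀≤J₀
    I≤J′ (suc r) = I≤J r
    J≤I′ : ∀ r s → suc (toℕ r) ≡ toℕ s → J r ≤ I s
    J≤I′ zero    (suc s) _     = J₀≤tail s
    J≤I′ (suc r) (suc s) 1+r≡s = J≤I r s (ℕₚ.suc-injective 1+r≡s)

MinorFormula : ∀ n {k} → (I J : Fin k → Fin n) → Set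
MinorFormula n I J = (I ⊴ J → minorT n J I ≡ + (2 ^ p I J)) × (¬ I ⊴ J → minorT n J I ≡ + 0)

minorFormula-vanishing : ∀ {n k} {I J : Fin k → Fin n} →
  ¬ I ⊴ J → minorT n J I ≡ + 0 → MinorFormula n I J
minorFormula-vanishing I⋬J minor≡0 = (λ I⊴J → ⊥-elim (I⋬J I⊴J)) , (λ _ → minor≡0)

minorFormula-step : ∀ {n k} {I J : Fin (suc k) → Fin n} (e : ℕ) →
  minorT n J I ≡ + (2 ^ e) * minorT n (tail J) (tail I) →
  p I J ≡ e ℕ.+ p (tail I) (tail J) →
  (tail I ⊴ tail J → I ⊴ J) →
  MinorFormula n (tail I) (tail J) → MinorFormula n I J
minorFormula-step {n} {I = I} {J} e minor≡ p≡ tail⊴⇒⊴ (tail⊴⇒formula , tail⋬⇒vanishing) =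
  ⊴⇒formula , ⋬⇒vanishing
  where
  p′ : ℕ
  p′ = p (tail I) (tail J)
  ⊴⇒formula : I ⊴ J → minorT n J I ≡ + (2 ^ p I J)
  ⊴⇒formula I⊴J = begin
    minorT n J I                             ≡⟨ minor≡ ⟩
    + (2 ^ e) * minorT n (tail J) (tail I)   ≡⟨ cong (_*_ (+ (2 ^ e))) (tail⊴⇒formula (⊴-tail I⊴J)) ⟩
    + (2 ^ e) * + (2 ^ p′)                   ≡⟨ sym (ℤₚ.pos-* (2 ^ e) (2 ^ p′)) ⟩
    + (2 ^ e ℕ.* 2 ^ p′)                     ≡⟨ cong +_ (sym (ℕₚ.^-distribˡ-+-* 2 e p′)) ⟩
    + (2 ^ (e ℕ.+ p′))                       ≡⟨ cong (λ x → + (2 ^ x)) (sym p≡) ⟩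
    + (2 ^ p I J)                            ∎
  ⋬⇒vanishing : ¬ I ⊴ J → minorT n J I ≡ + 0
  ⋬⇒vanishing I⋬J = begin
    minorT n J I                             ≡⟨ minor≡ ⟩
    + (2 ^ e) * minorT n (tail J) (tail I)   ≡⟨ cong (_*_ (+ (2 ^ e))) (tail⋬⇒vanishing (I⋬J ∘ tail⊴⇒⊴)) ⟩
    + (2 ^ e) * + 0                          ≡⟨ ℤₚ.*-zeroʳ (+ (2 ^ e)) ⟩
    + 0                                      ∎

module Cons {n k : ℕ} (I J : Fin (suc k) → Fin n)
  (I↑ : StrictlyIncreasing I) (J↑ : StrictlyIncreasing J)
  (ih : MinorFormula n (tail I) (tail J)) where

  private
    expand : minorT n J I ≡ alternatingRowSum n (J zero) I * minorT n (tail J) (tail I)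
    expand = minorT-expand I J I↑ J↑

    I₀<tail : ∀ c → I zero < I (suc c)
    I₀<tail c = I↑ zero (suc c) (s≤s z≤n)

  minorFormula-J₀<I₀ : J zero < I zero → MinorFormula n I J
  minorFormula-J₀<I₀ J₀<I₀ = minorFormula-vanishing
    (λ I⊴J → ℕₚ.<⇒≱ J₀<I₀ (proj₁ I⊴J zero))
    (trans expand (cong (_* minorT n (tail J) (tail I)) (alternatingRowSum-≡0 (J zero) I J₀<I)))
    where
    J₀<I : ∀ c → J zero < I c
    J₀<I c = ℕₚ.<-≤-trans J₀<I₀ (StrictlyIncreasing⇒monotone I↑ z≤n)

  minorFormula-I₀≡J₀ : I zero ≡ J zero → MinorFormula n I J
  minorFormula-I₀≡J₀ I₀≡J₀ = minorFormula-step 0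
    (trans expand (cong (_* minorT n (tail J) (tail I)) (alternatingRowSum-≡1 (J zero) I I₀≡J₀ J₀<tailI)))
    (p-tail-shared {I = I} {J = J} (trans (countIn-head-∈ {I = I} {J = J} (zero , I₀≡J₀)) (cong suc (countIn-tailʳ {I = tail I} {J = J} J₀<tailI))))
    (⊴-cons (ℕₚ.≤-reflexive (cong toℕ I₀≡J₀)) (ℕₚ.<⇒≤ ∘ J₀<tailI))
    ih
    where
    J₀<tailI : ∀ c → J zero < I (suc c)
    J₀<tailI c = subst (_< I (suc c)) I₀≡J₀ (I₀<tail c)

  minorFormula-I₀<J₀<tailI : I zero < J zero → (∀ c → J zero < I (suc c)) → MinorFormula n I J
  minorFormula-I₀<J₀<tailI I₀<J₀ J₀<tailI = minorFormula-step 1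
    (trans expand (cong (_* minorT n (tail J) (tail I)) (alternatingRowSum-≡2 (J zero) I I₀<J₀ J₀<tailI)))
    (p-tail-unshared {I = I} {J = J} (trans (countIn-tailˡ {I = I} {J = J} I₀<J) (countIn-tailʳ {I = tail I} {J = J} J₀<tailI)))
    (⊴-cons (ℕₚ.<⇒≤ I₀<J₀) (ℕₚ.<⇒≤ ∘ J₀<tailI))
    ih
    where
    I₀<J : ∀ s → I zero < J s
    I₀<J s = ℕₚ.<-≤-trans I₀<J₀ (StrictlyIncreasing⇒monotone J↑ z≤n)

J₀<tail²I⊎tail⋬ : ∀ {n k} (I J : Fin (suc (suc k)) → Fin n) →
  StrictlyIncreasing I → StrictlyIncreasing J →
  (∀ c → J zero < I (suc (suc c))) ⊎ ¬ tail I ⊴ tail J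
J₀<tail²I⊎tail⋬ {k = zero}  I J I↑ J↑ = inj₁ λ ()
J₀<tail²I⊎tail⋬ {k = suc k} I J I↑ J↑ with J (suc zero) ≤? I (suc (suc zero))
... | yes J₁≤I₂ = inj₁ λ c → ℕₚ.<-≤-trans (J↑ zero (suc zero) (s≤s z≤n))
                    (ℕₚ.≤-trans J₁≤I₂ (StrictlyIncreasing⇒monotone I↑ (s≤s (s≤s z≤n))))
... | no  J₁≰I₂ = inj₂ λ tail⊴ → J₁≰I₂ (proj₂ tail⊴ zero (suc zero) refl)

module Cons₂ {n k : ℕ} (I J : Fin (suc (suc k)) → Fin n)
  (I↑ : StrictlyIncreasing I) (J↑ : StrictlyIncreasing J)
  (ih : MinorFormula n (tail I) (tail J)) where

  private
    expand : minorT n J I ≡ alternatingRowSum n (J zero) I * minorT n (tail J) (tail I)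
    expand = minorT-expand I J I↑ J↑

    I₀<I₁ : I zero < I (suc zero)
    I₀<I₁ = I↑ zero (suc zero) (s≤s z≤n)

  minorFormula-I₁≡J₀ : I (suc zero) ≡ J zero → MinorFormula n I J
  minorFormula-I₁≡J₀ I₁≡J₀ = minorFormula-step 0
    (trans expand (cong (_* minorT n (tail J) (tail I)) rowSum≡1))
    (p-tail-shared {I = I} {J = J} count≡)
    (⊴-cons (ℕₚ.<⇒≤ I₀<J₀) J₀≤tailI)
    ih
    where
    I₀<J₀ : I zero < J zero
    I₀<J₀ = subst (I zero <_) I₁≡J₀ I₀<I₁
    I₀<J : ∀ s → I zero < J s
    I₀<J s = ℕₚ.<-≤-trans I₀<J₀ (StrictlyIncreasing⇒monotone J↑ z≤n)
    I₁<tailJ : ∀ s → I (suc zero) < J (suc s)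
    I₁<tailJ s = subst (_< J (suc s)) (sym I₁≡J₀) (J↑ zero (suc s) (s≤s z≤n))
    J₀≤tailI : ∀ s → J zero ≤ I (suc s)
    J₀≤tailI s = subst (_≤ I (suc s)) I₁≡J₀ (StrictlyIncreasing⇒monotone I↑ (s≤s z≤n))
    J₀<tail²I : ∀ c → J zero < I (suc (suc c))
    J₀<tail²I c = subst (_< I (suc (suc c))) I₁≡J₀ (I↑ (suc zero) (suc (suc c)) (s≤s (s≤s z≤n)))

    rowSum≡1 : alternatingRowSum n (J zero) I ≡ + 1
    rowSum≡1 = begin
      alternatingRowSum n (J zero) I               ≡⟨ alternatingRowSum-cons-< (J zero) I I₀<J₀ ⟩
      + 2 - alternatingRowSum n (J zero) (tail I)  ≡⟨ cong (_-_ (+ 2))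
                                                       (alternatingRowSum-≡1 (J zero) (tail I) I₁≡J₀ J₀<tail²I) ⟩
      + 2 - + 1                                    ∎

    count≡ : countIn I J ≡ suc (countIn (tail I) (tail J))
    count≡ = begin
      countIn I J                             ≡⟨ countIn-tailˡ {I = I} {J = J} I₀<J ⟩
      countIn (tail I) J                      ≡⟨ countIn-head-∈ {I = tail I} {J = J} (zero , I₁≡J₀) ⟩
      suc (countIn (tail (tail I)) J)         ≡⟨ cong suc (countIn-tailʳ {I = tail (tail I)} {J = J} J₀<tail²I) ⟩
      suc (countIn (tail (tail I)) (tail J))  ≡⟨ cong suc (sym (countIn-tailˡ {I = tail I} {J = tail J} I₁<tailJ)) ⟩
      suc (countIn (tail I) (tail J))         ∎

  minorFormula-I₁<J₀ : I (suc zero) < J zero → MinorFormula n I J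
  minorFormula-I₁<J₀ I₁<J₀ =
    minorFormula-vanishing (λ I⊴J → ℕₚ.<⇒≱ I₁<J₀ (proj₂ I⊴J zero (suc zero) refl)) minor≡0
    where
    I₀<J₀ : I zero < J zero
    I₀<J₀ = ℕₚ.<-trans I₀<I₁ I₁<J₀
    minor≡0 : minorT n J I ≡ + 0
    minor≡0 with J₀<tail²I⊎tail⋬ I J I↑ J↑
    ... | inj₁ J₀<tail²I = trans expand (cong (_* minorT n (tail J) (tail I))
          (trans (alternatingRowSum-cons-< (J zero) I I₀<J₀)
                 (cong (_-_ (+ 2)) (alternatingRowSum-≡2 (J zero) (tail I) I₁<J₀ J₀<tail²I))))
    ... | inj₂ tail⋬ = trans expand (trans (cong (_*_ (alternatingRowSum n (J zero) I)) (proj₂ ih tail⋬))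
                                          (ℤₚ.*-zeroʳ (alternatingRowSum n (J zero) I)))

minorFormula-cons : ∀ {n} k (I J : Fin (suc k) → Fin n) →
  StrictlyIncreasing I → StrictlyIncreasing J →
  MinorFormula n (tail I) (tail J) → MinorFormula n I J
minorFormula-cons k I J I↑ J↑ ih with <-cmp (I zero) (J zero)
... | tri> _ _ J₀<I₀ = Cons.minorFormula-J₀<I₀ I J I↑ J↑ ih J₀<I₀
... | tri≈ _ I₀≡J₀ _ = Cons.minorFormula-I₀≡J₀ I J I↑ J↑ ih I₀≡J₀
minorFormula-cons zero I J I↑ J↑ ih | tri< I₀<J₀ _ _ =
  Cons.minorFormula-I₀<J₀<tailI I J I↑ J↑ ih I₀<J₀ λ ()
minorFormula-cons (suc k) I J I↑ J↑ ih | tri< I₀<J₀ _ _ with <-cmp (J zero) (I (suc zero))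
... | tri< J₀<I₁ _ _ = Cons.minorFormula-I₀<J₀<tailI I J I↑ J↑ ih I₀<J₀
                         λ c → ℕₚ.<-≤-trans J₀<I₁ (StrictlyIncreasing⇒monotone I↑ (s≤s z≤n))
... | tri≈ _ J₀≡I₁ _ = Cons₂.minorFormula-I₁≡J₀ I J I↑ J↑ ih (sym J₀≡I₁)
... | tri> _ _ I₁<J₀ = Cons₂.minorFormula-I₁<J₀ I J I↑ J↑ ih I₁<J₀

lemma3 : (n k : ℕ) (I J : Fin k → Fin n) →
    StrictlyIncreasing I → StrictlyIncreasing J →
    (I ⊴ J → minorT n J I ≡ + (2 ^ p I J)) × (¬ (I ⊴ J) → minorT n J I ≡ + 0)
lemma3 n zero    I J I↑ J↑ = (λ _ → refl) , (λ I⋬J → ⊥-elim (I⋬J ((λ ()) , (λ ()))))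
lemma3 n (suc k) I J I↑ J↑ = minorFormula-cons k I J I↑ J↑
  (lemma3 n k (tail I) (tail J) (StrictlyIncreasing-tail I↑) (StrictlyIncreasing-tail J↑))
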